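{- Let $q$ be a prime power and $\lambda=(4,4,2,2)$. Under a uniformly random ring homomorphism $\Lambda\to\mathbb{F}_q$, $$P(s_\lambda\mapsto 0)=\begin{cases}\dfrac{q^4+(q-1)(q^2-q)}{q^5} & \text{if } q\equiv 0 \pmod 2,\\[2mm] \dfrac{q^4+(q-1)(q^2-q+1)}{q^5} & \text{if } q\equiv 1 \pmod 2.\end{cases}$$
   Context: $\Lambda$ is the ring of symmetric functions over $\mathbb{Z}$, $h_k$ the complete homogeneous symmetric functions, $s_\lambda$ the Schur functions. A uniformly random ring homomorphism $\Lambda\to\mathbb{F}_q$ is obtained by sending $h_1,h_2,\dots$ to independent uniformly random elements of $\mathbb{F}_q$. -}

module Defs where

open import Data.Nat using (ℕ; zero; suc; _+_; _*_; _∸_; _^_; _<_; _<?_)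
open import Data.Nat.Primality using (Prime)
open import Data.Fin using (Fin; zero; suc; toℕ; fromℕ<; punchIn; _≟_)
open import Data.Fin.Base using ()
open import Data.Vec using (Vec; []; _∷_; lookup)
open import Data.List using (List; []; _∷_; length; filter; concatMap; map)
open import Data.List.Base using (allFin)
open import Data.Product using (∃; _×_; _,_)
open import Relation.Nullary using (yes; no)
open import Relation.Binary.PropositionalEquality using (_≡_; _≢_)
open import Algebra.Structures using (IsCommutativeRing)

IsPrimePower : ℕ → Set
IsPrimePower q = ∃ λ p → ∃ λ k → Prime p × q ≡ p ^ suc k

-- A finite field with q elements, with underlying set Fin q
-- (every field of order q is isomorphic to one of this form).
record FiniteField (q : ℕ) : Set where
  field
    _+F_ _*F_ : Fin q → Fin q → Fin q
    -F_ : Fin q → Fin q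
    0F 1F : Fin q
    isCommutativeRing : IsCommutativeRing _≡_ _+F_ _*F_ -F_ 0F 1F
    0≢1 : 0F ≢ 1F
    inverse : ∀ x → x ≢ 0F → ∃ λ y → (x *F y) ≡ 1F

module _ {q : ℕ} (F : FiniteField q) where
  open FiniteField F

  signed : ℕ → Fin q → Fin q
  signed zero x = x
  signed (suc n) x = -F (signed n x)

  sumFin : ∀ n → (Fin n → Fin q) → Fin q
  sumFin zero f = 0F
  sumFin (suc n) f = f zero +F sumFin n (λ i → f (suc i))

  det : ∀ n → (Fin n → Fin n → Fin q) → Fin q
  det zero M = 1F
  det (suc n) M =
    sumFin (suc n) (λ j → signed (toℕ j) (M zero j *F det n (λ i k → M (suc i) (punchIn j k))))

  -- Jacobi–Trudi matrix entry h_{λ_i - i + j} (0-based i, j), with h_0 = 1,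
  -- h_k = 0 for k < 0, and h_k = h (k - 1) for k ≥ 1 (h = images of h_1, h_2, ...).
  hEntry : (ℕ → Fin q) → ℕ → ℕ → ℕ → Fin q
  hEntry h li i j with li + j <? i
  ... | yes _ = 0F
  ... | no _ with li + j ∸ i
  ...   | zero = 1F
  ...   | suc k = h k

  -- image of the Schur function s_λ (λ = (λ_1,...,λ_ℓ)) under the ring
  -- homomorphism Λ → F_q sending h_{k+1} to h k, via Jacobi–Trudi s_λ = det(h_{λ_i - i + j}).
  schurImage : ∀ ℓ → Vec ℕ ℓ → (ℕ → Fin q) → Fin q
  schurImage ℓ lam h = det ℓ (λ i j → hEntry h (lookup lam i) (toℕ i) (toℕ j))

  allVecs : ∀ m → List (Vec (Fin q) m)
  allVecs zero = [] ∷ []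
  allVecs (suc m) = concatMap (λ x → map (x ∷_) (allVecs m)) (allFin q)

  extend : ∀ {m} → Vec (Fin q) m → ℕ → Fin q
  extend {m} v k with k <? m
  ... | yes k<m = lookup v (fromℕ< k<m)
  ... | no _ = 0F

  zeroCount : ∀ ℓ → Vec ℕ ℓ → ℕ → ℕ
  zeroCount ℓ lam m =
    length (filter (λ v → schurImage ℓ lam (extend v) ≟ 0F) (allVecs m))

lam4422 : Vec ℕ 4
lam4422 = 4 ∷ 4 ∷ 2 ∷ 2 ∷ []

module Submission where

-- Only h₁, …, h₇ enter the Jacobi–Trudi determinant of λ = (4,4,2,2), so for m ≥ 7 the count is
-- q^(m−7) times the number of zeros of an explicit polynomial s on 𝔽_q⁷. Expanding the determinant,
--   s = (κ − h₅) h₇ + ρ(h₅, h₆)   and   ρ(κ, h₆) = (h₆ + α)(h₆ + β),   β − α = h₃ (h₃ + ε),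
-- with κ, α, β polynomials in h₁, …, h₄ and ε = h₁³ − 2h₁h₂. Counting the zeros one variable at
-- a time: in h₇ there is one zero unless h₅ = κ, where s no longer depends on h₇; in h₆ the
-- quadratic has two zeros unless α = β; that happens for two values of h₃, or one if ε = 0.
-- Altogether #zeros + 2q⁴ = q⁶ + q⁵ + q²·#{ε = 0}, and ε is affine in h₂ with slope −2h₁, so
-- #{ε = 0} is q in characteristic 2 and 2q − 1 otherwise. Finally |𝔽| is even exactly in
-- characteristic 2, as one sees from the fixed points of the involutions x ↦ x + 1 and x ↦ −x.

open import Defs using (IsPrimePower; FiniteField; schurImage; extend; allVecs; zeroCount; lam4422)

open import Algebra.Bundles using (CommutativeRing)

-- Integer coefficients make the constants of the ring solver computable, which those of an
-- abstract field are not.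
module IntegerCoefficients {c ℓ} (R : CommutativeRing c ℓ) where

  open import Algebra.Solver.Ring.AlmostCommutativeRing
    using (fromCommutativeRing; _-Raw-AlmostCommutative⟶_)
  open import Data.Integer.Base as ℤ using (ℤ; +_; -[1+_]; +[1+_]; _⊖_; _◃_; sign; ∣_∣; +-*-rawRing)
  import Data.Integer.Properties as ℤ
  open import Data.Maybe.Base using (Maybe; just; nothing)
  open import Data.Nat.Base as ℕ using (zero; suc)
  import Data.Nat.Properties as ℕ
  open import Data.Sign.Base as Sign using (Sign)
  open import Relation.Binary.PropositionalEquality as ≡ using (_≡_)
  open import Relation.Nullary using (yes; no)

  open CommutativeRing R
  open import Algebra.Properties.Ring ring
    using (-0#≈0#; -‿involutive; -‿+-comm; -‿distribˡ-*; -‿distribʳ-*)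
  open import Algebra.Properties.Semiring.Mult.TCOptimised semiring
    using (_×_; 1+×; ×-homo-+; ×1-homo-*)
  open import Algebra.Solver.CommutativeMonoid +-commutativeMonoid
    using (solve; _⊕_; _⊜_)
  open import Relation.Binary.Reasoning.Setoid setoid

  fromℤ : ℤ → Carrier
  fromℤ (+ n)    = n × 1#
  fromℤ -[1+ n ] = - (suc n × 1#)

  private
    shift-cancel : ∀ x a b → (x + a) - (x + b) ≈ a - b
    shift-cancel x a b = begin
      (x + a) + - (x + b)    ≈⟨ +-congˡ (sym (-‿+-comm x b)) ⟩
      (x + a) + (- x + - b)  ≈⟨ solve 4 (λ x a x' b → (x ⊕ a) ⊕ (x' ⊕ b) ⊜ (x ⊕ x') ⊕ (a ⊕ b)) refl x a (- x) (- b) ⟩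
      (x - x) + (a - b)      ≈⟨ +-congʳ (-‿inverseʳ x) ⟩
      0# + (a - b)           ≈⟨ +-identityˡ _ ⟩
      a - b                  ∎

  fromℤ-⊖ : ∀ m n → fromℤ (m ⊖ n) ≈ m × 1# - n × 1#
  fromℤ-⊖ m       zero    = sym (trans (+-congˡ -0#≈0#) (+-identityʳ _))
  fromℤ-⊖ zero    (suc n) = sym (+-identityˡ _)
  fromℤ-⊖ (suc m) (suc n) = begin
    fromℤ (suc m ⊖ suc n)          ≡⟨ ≡.cong fromℤ (ℤ.[1+m]⊖[1+n]≡m⊖n m n) ⟩
    fromℤ (m ⊖ n)                  ≈⟨ fromℤ-⊖ m n ⟩
    m × 1# - n × 1#                ≈⟨ shift-cancel 1# (m × 1#) (n × 1#) ⟨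
    (1# + m × 1#) - (1# + n × 1#)  ≈⟨ +-cong (sym (1+× m 1#)) (-‿cong (sym (1+× n 1#))) ⟩
    suc m × 1# - suc n × 1#        ∎

  fromℤ-+ : ∀ i j → fromℤ (i ℤ.+ j) ≈ fromℤ i + fromℤ j
  fromℤ-+ -[1+ m ] -[1+ n ] = begin
    - (suc (suc (m ℕ.+ n)) × 1#)       ≡⟨ ≡.cong (λ k → - (suc k × 1#)) (ℕ.+-suc m n) ⟨
    - ((suc m ℕ.+ suc n) × 1#)         ≈⟨ -‿cong (×-homo-+ 1# (suc m) (suc n)) ⟩
    - (suc m × 1# + suc n × 1#)        ≈⟨ -‿+-comm _ _ ⟨
    - (suc m × 1#) + - (suc n × 1#)    ∎
  fromℤ-+ -[1+ m ] (+ n)    = trans (fromℤ-⊖ n (suc m)) (+-comm _ _)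
  fromℤ-+ (+ m)    -[1+ n ] = fromℤ-⊖ m (suc n)
  fromℤ-+ (+ m)    (+ n)    = ×-homo-+ 1# m n

  fromℤ-neg : ∀ i → fromℤ (ℤ.- i) ≈ - fromℤ i
  fromℤ-neg (+ zero)  = sym -0#≈0#
  fromℤ-neg +[1+ n ]  = refl
  fromℤ-neg -[1+ n ]  = sym (-‿involutive _)

  private
    signed : Sign → Carrier → Carrier
    signed Sign.+ x = x
    signed Sign.- x = - x

    fromℤ-◃ : ∀ s n → fromℤ (s ◃ n) ≈ signed s (n × 1#)
    fromℤ-◃ Sign.+ zero    = refl
    fromℤ-◃ Sign.- zero    = sym -0#≈0#
    fromℤ-◃ Sign.+ (suc n) = refl
    fromℤ-◃ Sign.- (suc n) = refl

    fromℤ-signAbs : ∀ i → fromℤ i ≈ signed (sign i) (∣ i ∣ × 1#)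
    fromℤ-signAbs (+ zero)  = refl
    fromℤ-signAbs +[1+ n ]  = refl
    fromℤ-signAbs -[1+ n ]  = refl

    signed-* : ∀ s t x y → signed (s Sign.* t) (x * y) ≈ signed s x * signed t y
    signed-* Sign.+ Sign.+ x y = refl
    signed-* Sign.+ Sign.- x y = -‿distribʳ-* x y
    signed-* Sign.- Sign.+ x y = -‿distribˡ-* x y
    signed-* Sign.- Sign.- x y = begin
      x * y          ≈⟨ -‿involutive _ ⟨
      - - (x * y)    ≈⟨ -‿cong (-‿distribˡ-* x y) ⟩
      - (- x * y)    ≈⟨ -‿distribʳ-* (- x) y ⟩
      - x * - y      ∎

  fromℤ-* : ∀ i j → fromℤ (i ℤ.* j) ≈ fromℤ i * fromℤ j
  fromℤ-* i j = begin
    fromℤ (s ◃ ∣ i ∣ ℕ.* ∣ j ∣)                         ≈⟨ fromℤ-◃ s (∣ i ∣ ℕ.* ∣ j ∣) ⟩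
    signed s ((∣ i ∣ ℕ.* ∣ j ∣) × 1#)                    ≈⟨ signed-cong s (×1-homo-* ∣ i ∣ ∣ j ∣) ⟩
    signed s (∣ i ∣ × 1# * ∣ j ∣ × 1#)                   ≈⟨ signed-* (sign i) (sign j) _ _ ⟩
    signed (sign i) (∣ i ∣ × 1#) * signed (sign j) (∣ j ∣ × 1#) ≈⟨ *-cong (fromℤ-signAbs i) (fromℤ-signAbs j) ⟨
    fromℤ i * fromℤ j                                    ∎
    where
    s = sign i Sign.* sign j
    signed-cong : ∀ s {x y} → x ≈ y → signed s x ≈ signed s y
    signed-cong Sign.+ x≈y = x≈y
    signed-cong Sign.- x≈y = -‿cong x≈y

  fromℤ-homomorphism : +-*-rawRing -Raw-AlmostCommutative⟶ fromCommutativeRing R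
  fromℤ-homomorphism = record
    { ⟦_⟧ = fromℤ ; +-homo = fromℤ-+ ; *-homo = fromℤ-* ; -‿homo = fromℤ-neg
    ; 0-homo = refl ; 1-homo = refl }

  coefficient≟ : ∀ i j → Maybe (fromℤ i ≈ fromℤ j)
  coefficient≟ i j with i ℤ.≟ j
  ... | yes ≡.refl = just refl
  ... | no _       = nothing

  open import Algebra.Solver.Ring +-*-rawRing (fromCommutativeRing R) fromℤ-homomorphism coefficient≟
    public

open import Algebra.Bundles.Raw using (RawRing)
import Algebra.Properties.AbelianGroup as AbelianGroupProperties
open import Data.Fin using (Fin; zero; suc; toℕ; punchIn; fromℕ<; #_; _≟_)
import Data.Integer.Base as ℤ
open import Data.List.Base as List using (List; []; _∷_; [_]; length; filter; map; concat; tabulate; allFin)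
open import Data.List.Properties using (filter-++; length-++; map-tabulate)
open import Data.Nat.Base as ℕ using (ℕ; zero; suc)
import Data.Nat.Properties as ℕ
open import Data.Nat.Solver using (module +-*-Solver)
open import Data.Product.Base using (_×_; _,_)
open import Data.Sum.Base using (_⊎_; inj₁; inj₂; [_,_]′)
open import Data.Vec.Base using (Vec; []; _∷_; _++_; lookup)
open import Function.Base using (id; _∘_)
open import Level using (0ℓ)
open import Relation.Binary.PropositionalEquality
  using (_≡_; _≢_; refl; sym; trans; cong; cong₂; module ≡-Reasoning)
open import Relation.Nullary using (Dec; yes; no; does; ¬_)
open import Relation.Nullary.Negation using (contradiction)
open import Relation.Unary using (Pred; Decidable)

module Counting where

  open import Algebra.Properties.Semiring.Sum ℕ.+-*-semiring public
    using (sum-syntax; ∑-distrib-+; sum-cong-≗; *-distribˡ-sum)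
  open import Algebra.Properties.Semiring.Sum ℕ.+-*-semiring using (∑-permute)
  open import Data.Bool.Base using (true; false; if_then_else_)
  open import Data.Fin.Permutation using (permutation)
  open import Data.Fin.Properties using (toℕ-injective)
  open import Data.Nat using (_+_; _*_; _<?_; _%_)
  open import Data.Nat.DivMod using ([m+kn]%n≡m%n)
  open import Data.Nat.Properties using (+-identityʳ; +-comm; *-zeroʳ; *-identityʳ; *-comm; <-cmp)
  open import Relation.Binary.Definitions using (tri<; tri≈; tri>)

  -- Defined through `does` so that 𝟙 (suc i ≟ suc j) reduces to 𝟙 (i ≟ j).
  𝟙 : ∀ {p} {P : Set p} → Dec P → ℕ
  𝟙 P? = if does P? then 1 else 0

  𝟙-yes : ∀ {p} {P : Set p} (P? : Dec P) → P → 𝟙 P? ≡ 1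
  𝟙-yes (yes _) _  = refl
  𝟙-yes (no ¬p) p  = contradiction p ¬p

  𝟙-no : ∀ {p} {P : Set p} (P? : Dec P) → ¬ P → 𝟙 P? ≡ 0
  𝟙-no (yes p) ¬p = contradiction p ¬p
  𝟙-no (no _)  _  = refl

  𝟙-cong : ∀ {p q} {P : Set p} {Q : Set q} → (P → Q) → (Q → P) →
           (P? : Dec P) (Q? : Dec Q) → 𝟙 P? ≡ 𝟙 Q?
  𝟙-cong P⇒Q Q⇒P (yes p) Q? = sym (𝟙-yes Q? (P⇒Q p))
  𝟙-cong P⇒Q Q⇒P (no ¬p) Q? = sym (𝟙-no Q? (λ q → ¬p (Q⇒P q)))

  ∑-const : ∀ n c → ∑[ _ < n ] c ≡ n * c
  ∑-const zero    c = refl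
  ∑-const (suc n) c = cong (c +_) (∑-const n c)

  ∑-zero : ∀ n → ∑[ _ < n ] 0 ≡ 0
  ∑-zero n = trans (∑-const n 0) (*-zeroʳ n)

  ∑-𝟙-≡-* : ∀ {n} (c : Fin n) (g : Fin n → ℕ) → ∑[ i < n ] (𝟙 (i ≟ c) * g i) ≡ g c
  ∑-𝟙-≡-* {suc n} zero    g = trans (cong (g zero + 0 +_) (∑-zero n)) (trans (+-identityʳ _) (+-identityʳ _))
  ∑-𝟙-≡-* {suc n} (suc c) g = ∑-𝟙-≡-* c (λ i → g (suc i))

  ∑-𝟙-≡ : ∀ {n} (c : Fin n) → ∑[ i < n ] 𝟙 (i ≟ c) ≡ 1
  ∑-𝟙-≡ c = trans (sum-cong-≗ (λ i → sym (*-identityʳ (𝟙 (i ≟ c))))) (∑-𝟙-≡-* c (λ _ → 1))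

  module _ {n} (σ : Fin n → Fin n) (σ-involutive : ∀ x → σ (σ x) ≡ x) where

    private
      Fixed Ascent Descent : Fin n → ℕ
      Fixed   x = 𝟙 (σ x ≟ x)
      Ascent  x = 𝟙 (toℕ x <? toℕ (σ x))
      Descent x = 𝟙 (toℕ (σ x) <? toℕ x)

      trichotomy : ∀ x → Fixed x + (Ascent x + Descent x) ≡ 1
      trichotomy x with <-cmp (toℕ x) (toℕ (σ x))
      ... | tri< x<σx x≉σx σx≮x = cong₂ _+_ (𝟙-no (σ x ≟ x) (λ σx≡x → x≉σx (cong toℕ (sym σx≡x))))
        (cong₂ _+_ (𝟙-yes (toℕ x <? toℕ (σ x)) x<σx) (𝟙-no (toℕ (σ x) <? toℕ x) σx≮x))
      ... | tri≈ x≮σx x≈σx σx≮x = cong₂ _+_ (𝟙-yes (σ x ≟ x) (sym (toℕ-injective x≈σx)))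
        (cong₂ _+_ (𝟙-no (toℕ x <? toℕ (σ x)) x≮σx) (𝟙-no (toℕ (σ x) <? toℕ x) σx≮x))
      ... | tri> x≮σx x≉σx σx<x = cong₂ _+_ (𝟙-no (σ x ≟ x) (λ σx≡x → x≉σx (cong toℕ (sym σx≡x))))
        (cong₂ _+_ (𝟙-no (toℕ x <? toℕ (σ x)) x≮σx) (𝟙-yes (toℕ (σ x) <? toℕ x) σx<x))

      ∑-Descent≡∑-Ascent : ∑[ x < n ] Descent x ≡ ∑[ x < n ] Ascent x
      ∑-Descent≡∑-Ascent = trans (∑-permute Descent (permutation σ σ σ-involutive σ-involutive))
        (sum-cong-≗ (λ x → cong (λ y → 𝟙 (toℕ y <? toℕ (σ x))) (σ-involutive x)))

    -- The points moved by σ pair up as {x, σ x}; each pair has exactly one ascent.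
    involution-parity : n % 2 ≡ (∑[ x < n ] 𝟙 (σ x ≟ x)) % 2
    involution-parity = trans (cong (_% 2) fixed+pairs) ([m+kn]%n≡m%n (∑[ x < n ] Fixed x) (∑[ x < n ] Ascent x) 2)
      where
      open ≡-Reasoning
      fixed+pairs : n ≡ ∑[ x < n ] Fixed x + ∑[ x < n ] Ascent x * 2
      fixed+pairs = begin
        n                                          ≡⟨ sym (trans (∑-const n 1) (*-identityʳ n)) ⟩
        ∑[ x < n ] 1                               ≡⟨ sym (sum-cong-≗ trichotomy) ⟩
        ∑[ x < n ] (Fixed x + (Ascent x + Descent x))
          ≡⟨ trans (∑-distrib-+ Fixed _) (cong (∑[ x < n ] Fixed x +_) (∑-distrib-+ Ascent Descent)) ⟩
        ∑[ x < n ] Fixed x + (∑[ x < n ] Ascent x + ∑[ x < n ] Descent x)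
          ≡⟨ cong (λ d → ∑[ x < n ] Fixed x + (∑[ x < n ] Ascent x + d)) ∑-Descent≡∑-Ascent ⟩
        ∑[ x < n ] Fixed x + (∑[ x < n ] Ascent x + ∑[ x < n ] Ascent x)
          ≡⟨ cong (∑[ x < n ] Fixed x +_) (sym (*-two (∑[ x < n ] Ascent x))) ⟩
        ∑[ x < n ] Fixed x + ∑[ x < n ] Ascent x * 2 ∎
        where
        *-two : ∀ m → m * 2 ≡ m + m
        *-two m = trans (*-comm m 2) (cong (m +_) (+-identityʳ m))

  ∑-except : ∀ {n} (c : Fin n) (f : Fin n → ℕ) {a} → (∀ i → i ≢ c → f i ≡ a) →
             ∑[ i < n ] f i + a ≡ n * a + f c
  ∑-except {n} c f {a} f≡a = begin
    ∑[ i < n ] f i + a                          ≡⟨ cong (∑[ i < n ] f i +_) (∑-𝟙-≡-* c (λ _ → a)) ⟨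
    ∑[ i < n ] f i + ∑[ i < n ] (𝟙 (i ≟ c) * a)  ≡⟨ ∑-distrib-+ f (λ i → 𝟙 (i ≟ c) * a) ⟨
    ∑[ i < n ] (f i + 𝟙 (i ≟ c) * a)            ≡⟨ sum-cong-≗ swap ⟩
    ∑[ i < n ] (a + 𝟙 (i ≟ c) * f c)            ≡⟨ ∑-distrib-+ (λ _ → a) (λ i → 𝟙 (i ≟ c) * f c) ⟩
    ∑[ i < n ] a + ∑[ i < n ] (𝟙 (i ≟ c) * f c)  ≡⟨ cong₂ _+_ (∑-const n a) (∑-𝟙-≡-* c (λ _ → f c)) ⟩
    n * a + f c                                 ∎
    where
    open ≡-Reasoning
    swap : ∀ i → f i + 𝟙 (i ≟ c) * a ≡ a + 𝟙 (i ≟ c) * f c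
    swap i with i ≟ c
    ... | yes refl = trans (+-comm (f c) (a + 0)) (cong₂ _+_ (+-identityʳ a) (sym (+-identityʳ (f c))))
    ... | no i≢c   = cong (_+ 0) (f≡a i i≢c)

  module _ {a p} {A : Set a} {P : Pred A p} (P? : Decidable P) where

    length-filter-++ : ∀ xs ys → length (filter P? (xs List.++ ys)) ≡ length (filter P? xs) + length (filter P? ys)
    length-filter-++ xs ys = trans (cong length (filter-++ P? xs ys)) (length-++ (filter P? xs))

    length-filter-concat-tabulate : ∀ {n} (g : Fin n → List A) →
      length (filter P? (concat (tabulate g))) ≡ ∑[ i < n ] length (filter P? (g i))
    length-filter-concat-tabulate {zero}  g = refl
    length-filter-concat-tabulate {suc n} g = trans (length-filter-++ (g zero) (concat (tabulate (g ∘ suc))))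
      (cong (length (filter P? (g zero)) +_) (length-filter-concat-tabulate (g ∘ suc)))

    length-filter-singleton : ∀ x → length (filter P? [ x ]) ≡ 𝟙 (P? x)
    length-filter-singleton x with does (P? x)
    ... | true  = refl
    ... | false = refl

  length-filter-map : ∀ {a b p} {A : Set a} {B : Set b} {P : Pred B p} (P? : Decidable P) (f : A → B) xs →
                      length (filter P? (map f xs)) ≡ length (filter (P? ∘ f) xs)
  length-filter-map P? f []       = refl
  length-filter-map P? f (x ∷ xs) with does (P? (f x))
  ... | true  = cong suc (length-filter-map P? f xs)
  ... | false = length-filter-map P? f xs

open Counting

-- Defs.det and Defs.hEntry over an arbitrary raw ring: instantiated with solver polynomials,
-- the evaluation of `schur` is definitionally Defs.schurImage, so the ring solver can expand it.
module JacobiTrudi {c ℓ} (R : RawRing c ℓ) where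

  open RawRing R

  signed : ℕ → Carrier → Carrier
  signed zero    x = x
  signed (suc n) x = - signed n x

  sumFin : ∀ n → (Fin n → Carrier) → Carrier
  sumFin zero    f = 0#
  sumFin (suc n) f = f zero + sumFin n (λ i → f (suc i))

  det : ∀ n → (Fin n → Fin n → Carrier) → Carrier
  det zero    M = 1#
  det (suc n) M =
    sumFin (suc n) (λ j → signed (toℕ j) (M zero j * det n (λ i k → M (suc i) (punchIn j k))))

  hEntry : (ℕ → Carrier) → ℕ → ℕ → ℕ → Carrier
  hEntry h li i j with li ℕ.+ j ℕ.<? i
  ... | yes _ = 0#
  ... | no _ with li ℕ.+ j ℕ.∸ i
  ...   | zero  = 1#
  ...   | suc k = h k

  schur : ∀ len → Vec ℕ len → (ℕ → Carrier) → Carrier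
  schur len lam h = det len (λ i j → hEntry h (lookup lam i) (toℕ i) (toℕ j))

-- Over an arbitrary raw ring, so that the same formulas are field functions and solver polynomials.
module Schur4422 {c ℓ} (R : RawRing c ℓ) where

  open RawRing R

  infixl 6 _-_
  _-_ : Carrier → Carrier → Carrier
  x - y = x + - y

  κ α β : Carrier → Carrier → Carrier → Carrier → Carrier
  κ h₁ h₂ h₃ h₄ = h₁ * h₄ + h₂ * h₃ - h₁ * h₁ * h₃
  α h₁ h₂ h₃ h₄ = h₁ * h₂ * h₃ - h₃ * h₃ - h₂ * h₄
  β h₁ h₂ h₃ h₄ = h₁ * h₁ * h₁ * h₃ - h₁ * h₂ * h₃ - h₂ * h₄

  σ : Carrier → Carrier → Carrier → Carrier → Carrier → Carrier → Carrier
  σ h₁ h₂ h₃ h₄ h₅ h₆ = h₃ * h₄ + h₂ * h₅ - h₁ * h₆ + h₁ * h₃ * h₃ - h₁ * h₁ * h₂ * h₃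

  ε : Carrier → Carrier → Carrier
  ε h₁ h₂ = - (h₁ + h₁) * h₂ + h₁ * h₁ * h₁

  ρ : Carrier → Carrier → Carrier → Carrier → Carrier → Carrier → Carrier
  ρ h₁ h₂ h₃ h₄ h₅ h₆ =
    (h₆ + α h₁ h₂ h₃ h₄) * (h₆ + β h₁ h₂ h₃ h₄) + (h₅ - κ h₁ h₂ h₃ h₄) * σ h₁ h₂ h₃ h₄ h₅ h₆

  s₄₄₂₂ : Carrier → Carrier → Carrier → Carrier → Carrier → Carrier → Carrier → Carrier
  s₄₄₂₂ h₁ h₂ h₃ h₄ h₅ h₆ h₇ = (κ h₁ h₂ h₃ h₄ - h₅) * h₇ + ρ h₁ h₂ h₃ h₄ h₅ h₆

module FiniteFieldCounting {q} (F : FiniteField q) where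

  commutativeRing : CommutativeRing 0ℓ 0ℓ
  commutativeRing = record { isCommutativeRing = FiniteField.isCommutativeRing F }

  open FiniteField F using (inverse)
  open CommutativeRing commutativeRing using (_+_; _*_; -_; _-_; 0#; 1#; +-abelianGroup)
  private
    module R = CommutativeRing commutativeRing
    module G = AbelianGroupProperties +-abelianGroup

  inverse-cancelˡ : ∀ {a a⁻¹} → a * a⁻¹ ≡ 1# → ∀ y → a⁻¹ * (a * y) ≡ y
  inverse-cancelˡ {a} {a⁻¹} aa⁻¹≡1 y = begin
    a⁻¹ * (a * y)  ≡⟨ R.*-assoc a⁻¹ a y ⟨
    a⁻¹ * a * y    ≡⟨ cong (_* y) (trans (R.*-comm a⁻¹ a) aa⁻¹≡1) ⟩
    1# * y         ≡⟨ R.*-identityˡ y ⟩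
    y              ∎
    where open ≡-Reasoning

  x*y≡0⇒x≡0∨y≡0 : ∀ x y → x * y ≡ 0# → x ≡ 0# ⊎ y ≡ 0#
  x*y≡0⇒x≡0∨y≡0 x y xy≡0 with x ≟ 0#
  ... | yes x≡0 = inj₁ x≡0
  ... | no  x≢0 with inverse x x≢0
  ...   | x⁻¹ , xx⁻¹≡1 =
    inj₂ (trans (sym (inverse-cancelˡ xx⁻¹≡1 y)) (trans (cong (x⁻¹ *_) xy≡0) (R.zeroʳ x⁻¹)))

  x*x*x≡0⇒x≡0 : ∀ x → x * x * x ≡ 0# → x ≡ 0#
  x*x*x≡0⇒x≡0 x x³≡0 with x*y≡0⇒x≡0∨y≡0 (x * x) x x³≡0
  ... | inj₁ x²≡0 = [ id , id ]′ (x*y≡0⇒x≡0∨y≡0 x x x²≡0)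
  ... | inj₂ x≡0  = x≡0

  #roots : (Fin q → Fin q) → ℕ
  #roots f = ∑[ y < q ] 𝟙 (f y ≟ 0#)

  #roots-unique : ∀ f y₀ → f y₀ ≡ 0# → (∀ y → f y ≡ 0# → y ≡ y₀) → #roots f ≡ 1
  #roots-unique f y₀ fy₀≡0 root⇒y₀ =
    trans (sum-cong-≗ (λ y → 𝟙-cong (root⇒y₀ y) (λ { refl → fy₀≡0 }) (f y ≟ 0#) (y ≟ y₀))) (∑-𝟙-≡ y₀)

  #roots-affine : ∀ a b → a ≢ 0# → #roots (λ y → a * y + b) ≡ 1
  #roots-affine a b a≢0 with inverse a a≢0
  ... | a⁻¹ , aa⁻¹≡1 = #roots-unique _ (a⁻¹ * - b) is-root only-root
    where
    open ≡-Reasoning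
    only-root : ∀ y → a * y + b ≡ 0# → y ≡ a⁻¹ * - b
    only-root y root = trans (sym (inverse-cancelˡ aa⁻¹≡1 y)) (cong (a⁻¹ *_) (G.inverseˡ-unique (a * y) b root))
    is-root : a * (a⁻¹ * - b) + b ≡ 0#
    is-root = begin
      a * (a⁻¹ * - b) + b  ≡⟨ cong (_+ b) (R.*-assoc a a⁻¹ (- b)) ⟨
      a * a⁻¹ * - b + b    ≡⟨ cong (λ c → c * - b + b) aa⁻¹≡1 ⟩
      1# * - b + b         ≡⟨ cong (_+ b) (R.*-identityˡ (- b)) ⟩
      - b + b              ≡⟨ R.-‿inverseˡ b ⟩
      0#                   ∎

  #roots-flat : ∀ a b → a ≡ 0# → #roots (λ y → a * y + b) ≡ q ℕ.* 𝟙 (b ≟ 0#)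
  #roots-flat a b refl = trans (sum-cong-≗ λ y → cong (λ c → 𝟙 (c ≟ 0#)) (0y+b≡b y)) (∑-const q (𝟙 (b ≟ 0#)))
    where
    0y+b≡b : ∀ y → 0# * y + b ≡ b
    0y+b≡b y = trans (cong (_+ b) (R.zeroˡ y)) (R.+-identityˡ b)

  #roots-product : ∀ a b → #roots (λ y → (y + a) * (y + b)) ℕ.+ 𝟙 (a ≟ b) ≡ 2
  #roots-product a b = ℕ.+-cancelʳ-≡ _ _ _ (begin
    #roots (λ y → (y + a) * (y + b)) ℕ.+ 𝟙 (a ≟ b) ℕ.+ 0      ≡⟨ ℕ.+-identityʳ _ ⟩
    #roots (λ y → (y + a) * (y + b)) ℕ.+ 𝟙 (a ≟ b)
      ≡⟨ cong (#roots (λ y → (y + a) * (y + b)) ℕ.+_) both-roots ⟨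
    #roots (λ y → (y + a) * (y + b)) ℕ.+ ∑[ y < q ] (𝟙 (y ≟ - a) ℕ.* 𝟙 (y ≟ - b))
      ≡⟨ ∑-distrib-+ {q} _ _ ⟨
    ∑[ y < q ] (𝟙 ((y + a) * (y + b) ≟ 0#) ℕ.+ 𝟙 (y ≟ - a) ℕ.* 𝟙 (y ≟ - b))
      ≡⟨ sum-cong-≗ inclusion-exclusion ⟩
    ∑[ y < q ] (𝟙 (y ≟ - a) ℕ.+ 𝟙 (y ≟ - b))
      ≡⟨ ∑-distrib-+ {q} _ _ ⟩
    ∑[ y < q ] 𝟙 (y ≟ - a) ℕ.+ ∑[ y < q ] 𝟙 (y ≟ - b)       ≡⟨ cong₂ ℕ._+_ (∑-𝟙-≡ (- a)) (∑-𝟙-≡ (- b)) ⟩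
    2 ℕ.+ 0                                               ∎)
    where
    open ≡-Reasoning
    root⇒ : ∀ y c → y + c ≡ 0# → y ≡ - c
    root⇒ y c = G.inverseˡ-unique y c
    ⇒root : ∀ y c → y ≡ - c → y + c ≡ 0#
    ⇒root _ c refl = R.-‿inverseˡ c
    both-roots : ∑[ y < q ] (𝟙 (y ≟ - a) ℕ.* 𝟙 (y ≟ - b)) ≡ 𝟙 (a ≟ b)
    both-roots = trans (∑-𝟙-≡-* (- a) (λ y → 𝟙 (y ≟ - b)))
      (𝟙-cong (λ -a≡-b → trans (sym (G.⁻¹-involutive a)) (trans (cong (λ c → - c) -a≡-b) (G.⁻¹-involutive b)))
              (cong (λ c → - c)) (- a ≟ - b) (a ≟ b))
    inclusion-exclusion : ∀ y → 𝟙 ((y + a) * (y + b) ≟ 0#) ℕ.+ 𝟙 (y ≟ - a) ℕ.* 𝟙 (y ≟ - b)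
                                ≡ 𝟙 (y ≟ - a) ℕ.+ 𝟙 (y ≟ - b)
    inclusion-exclusion y with y ≟ - a | y ≟ - b
    ... | yes y≡-a | y≟-b = cong₂ ℕ._+_
      (𝟙-yes ((y + a) * (y + b) ≟ 0#) (trans (cong (_* (y + b)) (⇒root y a y≡-a)) (R.zeroˡ (y + b))))
      (ℕ.+-identityʳ (𝟙 y≟-b))
    ... | no _ | yes y≡-b = trans (ℕ.+-identityʳ _)
      (𝟙-yes ((y + a) * (y + b) ≟ 0#) (trans (cong ((y + a) *_) (⇒root y b y≡-b)) (R.zeroʳ (y + a))))
    ... | no y≢-a | no y≢-b = trans (ℕ.+-identityʳ _) (𝟙-no ((y + a) * (y + b) ≟ 0#) λ prod≡0 →
      [ (λ y+a≡0 → y≢-a (root⇒ y a y+a≡0)) , (λ y+b≡0 → y≢-b (root⇒ y b y+b≡0)) ]′ (x*y≡0⇒x≡0∨y≡0 _ _ prod≡0))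

  #roots-pencil : ∀ k (r : Fin q → Fin q → Fin q) →
    ∑[ x < q ] ∑[ y < q ] #roots (λ z → (k - x) * z + r x y) ℕ.+ q ≡ q ℕ.* q ℕ.+ q ℕ.* #roots (r k)
  #roots-pencil k r = begin
    ∑[ x < q ] ∑[ y < q ] #roots (λ z → (k - x) * z + r x y) ℕ.+ q
      ≡⟨ ∑-except k (λ x → ∑[ y < q ] #roots (λ z → (k - x) * z + r x y)) generic ⟩
    q ℕ.* q ℕ.+ ∑[ y < q ] #roots (λ z → (k - k) * z + r k y)
      ≡⟨ cong (q ℕ.* q ℕ.+_) (sum-cong-≗ λ y → #roots-flat (k - k) (r k y) (R.-‿inverseʳ k)) ⟩
    q ℕ.* q ℕ.+ ∑[ y < q ] (q ℕ.* 𝟙 (r k y ≟ 0#))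
      ≡⟨ cong (q ℕ.* q ℕ.+_) (*-distribˡ-sum q (λ y → 𝟙 (r k y ≟ 0#))) ⟨
    q ℕ.* q ℕ.+ q ℕ.* #roots (r k) ∎
    where
    open ≡-Reasoning
    generic : ∀ x → x ≢ k → ∑[ y < q ] #roots (λ z → (k - x) * z + r x y) ≡ q
    generic x x≢k = trans (sum-cong-≗ λ y → #roots-affine (k - x) (r x y) (λ k-x≡0 → x≢k (sym (G.x∙y⁻¹≈ε⇒x≈y k x k-x≡0))))
      (trans (∑-const q 1) (ℕ.*-identityʳ q))

  two : Fin q
  two = 1# + 1#

  x+x≡two*x : ∀ x → x + x ≡ two * x
  x+x≡two*x x = sym (trans (R.distribʳ x 1# 1#) (cong₂ _+_ (R.*-identityˡ x) (R.*-identityˡ x)))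

  two≡0⇒even : two ≡ 0# → q ℕ.% 2 ≡ 0
  two≡0⇒even 2≡0 = trans (involution-parity (_+ 1#) +1-involutive)
    (cong (ℕ._% 2) (trans (sum-cong-≗ λ x → 𝟙-no (x + 1# ≟ x) (no-fixed-point x)) (∑-zero q)))
    where
    +1-involutive : ∀ x → x + 1# + 1# ≡ x
    +1-involutive x = trans (R.+-assoc x 1# 1#) (trans (cong (x +_) 2≡0) (R.+-identityʳ x))
    no-fixed-point : ∀ x → x + 1# ≢ x
    no-fixed-point x x+1≡x = FiniteField.0≢1 F (begin
      0#            ≡⟨ R.-‿inverseˡ x ⟨
      - x + x       ≡⟨ cong (- x +_) x+1≡x ⟨
      - x + (x + 1#) ≡⟨ R.+-assoc (- x) x 1# ⟨
      - x + x + 1#  ≡⟨ cong (_+ 1#) (R.-‿inverseˡ x) ⟩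
      0# + 1#       ≡⟨ R.+-identityˡ 1# ⟩
      1#            ∎)
      where open ≡-Reasoning

  two≢0⇒odd : two ≢ 0# → q ℕ.% 2 ≡ 1
  two≢0⇒odd 2≢0 = trans (involution-parity (λ x → - x) G.⁻¹-involutive)
    (cong (ℕ._% 2) (trans (sum-cong-≗ λ x → 𝟙-cong (fixed⇒0 x) (λ { refl → G.ε⁻¹≈ε }) (- x ≟ x) (x ≟ 0#)) (∑-𝟙-≡ 0#)))
    where
    fixed⇒0 : ∀ x → - x ≡ x → x ≡ 0#
    fixed⇒0 x -x≡x with x*y≡0⇒x≡0∨y≡0 two x
      (trans (sym (x+x≡two*x x)) (trans (cong (_+ x) (sym -x≡x)) (R.-‿inverseˡ x)))
    ... | inj₁ 2≡0 = contradiction 2≡0 2≢0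
    ... | inj₂ x≡0 = x≡0

  even⇒two≡0 : q ℕ.% 2 ≡ 0 → two ≡ 0#
  even⇒two≡0 q-even with two ≟ 0#
  ... | yes 2≡0 = 2≡0
  ... | no  2≢0 = contradiction (trans (sym q-even) (two≢0⇒odd 2≢0)) λ ()

  odd⇒two≢0 : q ℕ.% 2 ≡ 1 → two ≢ 0#
  odd⇒two≢0 q-odd 2≡0 = contradiction (trans (sym q-odd) (two≡0⇒even 2≡0)) λ ()

  ∑ⱽ : ∀ n → (Vec (Fin q) n → ℕ) → ℕ
  ∑ⱽ zero    f = f []
  ∑ⱽ (suc n) f = ∑[ x < q ] ∑ⱽ n (λ v → f (x ∷ v))

  ∑ⱽ-cong : ∀ n {f g : Vec (Fin q) n → ℕ} → (∀ v → f v ≡ g v) → ∑ⱽ n f ≡ ∑ⱽ n g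
  ∑ⱽ-cong zero    f≡g = f≡g []
  ∑ⱽ-cong (suc n) f≡g = sum-cong-≗ λ x → ∑ⱽ-cong n (λ v → f≡g (x ∷ v))

  ∑ⱽ-++ : ∀ m n (f : Vec (Fin q) (m ℕ.+ n) → ℕ) → ∑ⱽ (m ℕ.+ n) f ≡ ∑ⱽ m (λ u → ∑ⱽ n (λ w → f (u ++ w)))
  ∑ⱽ-++ zero    n f = refl
  ∑ⱽ-++ (suc m) n f = sum-cong-≗ λ x → ∑ⱽ-++ m n (λ v → f (x ∷ v))

  ∑ⱽ-distrib-+ : ∀ n (f g : Vec (Fin q) n → ℕ) → ∑ⱽ n (λ v → f v ℕ.+ g v) ≡ ∑ⱽ n f ℕ.+ ∑ⱽ n g
  ∑ⱽ-distrib-+ zero    f g = refl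
  ∑ⱽ-distrib-+ (suc n) f g =
    trans (sum-cong-≗ λ x → ∑ⱽ-distrib-+ n (λ v → f (x ∷ v)) (λ v → g (x ∷ v))) (∑-distrib-+ {q} _ _)

  *-distribˡ-∑ⱽ : ∀ n a (f : Vec (Fin q) n → ℕ) → a ℕ.* ∑ⱽ n f ≡ ∑ⱽ n (λ v → a ℕ.* f v)
  *-distribˡ-∑ⱽ zero    a f = refl
  *-distribˡ-∑ⱽ (suc n) a f = trans (*-distribˡ-sum {q} a _) (sum-cong-≗ λ x → *-distribˡ-∑ⱽ n a (λ v → f (x ∷ v)))

  ∑ⱽ-const : ∀ n c → ∑ⱽ n (λ _ → c) ≡ q ℕ.^ n ℕ.* c
  ∑ⱽ-const zero    c = sym (ℕ.+-identityʳ c)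
  ∑ⱽ-const (suc n) c = trans (sum-cong-≗ {q} λ _ → ∑ⱽ-const n c)
    (trans (∑-const q (q ℕ.^ n ℕ.* c)) (sym (ℕ.*-assoc q (q ℕ.^ n) c)))

  length-filter-allVecs : ∀ m {p} {P : Pred (Vec (Fin q) m) p} (P? : Decidable P) →
                          length (filter P? (allVecs F m)) ≡ ∑ⱽ m (𝟙 ∘ P?)
  length-filter-allVecs zero    P? = length-filter-singleton P? []
  length-filter-allVecs (suc m) P? = begin
    length (filter P? (concat (map prefixed (allFin q))))
      ≡⟨ cong (length ∘ filter P? ∘ concat) (map-tabulate id prefixed) ⟩
    length (filter P? (concat (tabulate prefixed)))
      ≡⟨ length-filter-concat-tabulate P? prefixed ⟩
    ∑[ x < q ] length (filter P? (prefixed x))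
      ≡⟨ sum-cong-≗ (λ x → trans (length-filter-map P? (x ∷_) (allVecs F m)) (length-filter-allVecs m (P? ∘ (x ∷_)))) ⟩
    ∑ⱽ (suc m) (𝟙 ∘ P?) ∎
    where
    open ≡-Reasoning
    prefixed : Fin q → List (Vec (Fin q) (suc m))
    prefixed x = map (x ∷_) (allVecs F m)

module Schur4422Count {q} (F : FiniteField q) where

  open FiniteFieldCounting F
  open CommutativeRing commutativeRing using (_+_; _*_; -_; _-_; 0#; 1#; rawRing; +-abelianGroup)
  private
    module R = CommutativeRing commutativeRing
    module G = AbelianGroupProperties +-abelianGroup
  open Schur4422 rawRing using (κ; α; β; ε; ρ; s₄₄₂₂)

  -- Keeps the field solver's operator names apart from those of the ℕ solver used further down.
  module _ where

    open IntegerCoefficients commutativeRing using (Polynomial; con; var; _:+_; _:*_; :-_; prove; solve; _:=_)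

    polynomialRawRing : ℕ → RawRing 0ℓ 0ℓ
    polynomialRawRing n = record
      { Carrier = Polynomial n ; _≈_ = _≡_ ; _+_ = _:+_ ; _*_ = _:*_ ; -_ = :-_
      ; 0# = con (ℤ.+ 0) ; 1# = con (ℤ.+ 1) }

    private
      module Symbolic {n} = Schur4422 (polynomialRawRing n)

    hVariable : ℕ → Polynomial 7
    hVariable k with k ℕ.<? 7
    ... | yes k<7 = var (fromℕ< k<7)
    ... | no _    = con (ℤ.+ 0)

    schurImage-4422 : ∀ {t} h₁ h₂ h₃ h₄ h₅ h₆ h₇ (w : Vec (Fin q) t) →
      schurImage F 4 lam4422 (extend F (h₁ ∷ h₂ ∷ h₃ ∷ h₄ ∷ h₅ ∷ h₆ ∷ h₇ ∷ w)) ≡ s₄₄₂₂ h₁ h₂ h₃ h₄ h₅ h₆ h₇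
    schurImage-4422 h₁ h₂ h₃ h₄ h₅ h₆ h₇ w =
      prove (h₁ ∷ h₂ ∷ h₃ ∷ h₄ ∷ h₅ ∷ h₆ ∷ h₇ ∷ [])
        (JacobiTrudi.schur (polynomialRawRing 7) 4 lam4422 hVariable)
        (Symbolic.s₄₄₂₂ (var (# 0)) (var (# 1)) (var (# 2)) (var (# 3)) (var (# 4)) (var (# 5)) (var (# 6)))
        refl

    ρ-at-κ : ∀ h₁ h₂ h₃ h₄ h₆ →
      ρ h₁ h₂ h₃ h₄ (κ h₁ h₂ h₃ h₄) h₆ ≡ (h₆ + α h₁ h₂ h₃ h₄) * (h₆ + β h₁ h₂ h₃ h₄)
    ρ-at-κ = solve 5 (λ h₁ h₂ h₃ h₄ h₆ → Symbolic.ρ h₁ h₂ h₃ h₄ (Symbolic.κ h₁ h₂ h₃ h₄) h₆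
                                        := (h₆ :+ Symbolic.α h₁ h₂ h₃ h₄) :* (h₆ :+ Symbolic.β h₁ h₂ h₃ h₄)) refl

    β-α : ∀ h₁ h₂ h₃ h₄ → β h₁ h₂ h₃ h₄ - α h₁ h₂ h₃ h₄ ≡ h₃ * (h₃ + ε h₁ h₂)
    β-α = solve 4 (λ h₁ h₂ h₃ h₄ → Symbolic.β h₁ h₂ h₃ h₄ :+ :- Symbolic.α h₁ h₂ h₃ h₄
                                 := h₃ :* (h₃ :+ Symbolic.ε h₁ h₂)) refl

  s₄₄₂₂ⱽ : Vec (Fin q) 7 → Fin q
  s₄₄₂₂ⱽ (h₁ ∷ h₂ ∷ h₃ ∷ h₄ ∷ h₅ ∷ h₆ ∷ h₇ ∷ []) = s₄₄₂₂ h₁ h₂ h₃ h₄ h₅ h₆ h₇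

  zeroCount-4422 : ∀ t → zeroCount F 4 lam4422 (7 ℕ.+ t) ≡ q ℕ.^ t ℕ.* ∑ⱽ 7 (λ u → 𝟙 (s₄₄₂₂ⱽ u ≟ 0#))
  zeroCount-4422 t = begin
    zeroCount F 4 lam4422 (7 ℕ.+ t)
      ≡⟨ length-filter-allVecs (7 ℕ.+ t) (λ v → s v ≟ 0#) ⟩
    ∑ⱽ (7 ℕ.+ t) (λ v → 𝟙 (s v ≟ 0#))
      ≡⟨ ∑ⱽ-++ 7 t (λ v → 𝟙 (s v ≟ 0#)) ⟩
    ∑ⱽ 7 (λ u → ∑ⱽ t (λ w → 𝟙 (s (u ++ w) ≟ 0#)))
      ≡⟨ ∑ⱽ-cong 7 (λ u → trans (∑ⱽ-cong t λ w → cong (λ c → 𝟙 (c ≟ 0#)) (only-7 u w)) (∑ⱽ-const t _)) ⟩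
    ∑ⱽ 7 (λ u → q ℕ.^ t ℕ.* 𝟙 (s₄₄₂₂ⱽ u ≟ 0#))
      ≡⟨ *-distribˡ-∑ⱽ 7 (q ℕ.^ t) (λ u → 𝟙 (s₄₄₂₂ⱽ u ≟ 0#)) ⟨
    q ℕ.^ t ℕ.* ∑ⱽ 7 (λ u → 𝟙 (s₄₄₂₂ⱽ u ≟ 0#)) ∎
    where
    open ≡-Reasoning
    s : ∀ {m} → Vec (Fin q) m → Fin q
    s v = schurImage F 4 lam4422 (extend F v)
    only-7 : ∀ (u : Vec (Fin q) 7) (w : Vec (Fin q) t) → s (u ++ w) ≡ s₄₄₂₂ⱽ u
    only-7 (h₁ ∷ h₂ ∷ h₃ ∷ h₄ ∷ h₅ ∷ h₆ ∷ h₇ ∷ []) w = schurImage-4422 h₁ h₂ h₃ h₄ h₅ h₆ h₇ w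

  zerosOver : Vec (Fin q) 4 → ℕ
  zerosOver u = ∑ⱽ 3 (λ w → 𝟙 (s₄₄₂₂ⱽ (u ++ w) ≟ 0#))

  doubleRoot : Vec (Fin q) 4 → ℕ
  doubleRoot (h₁ ∷ h₂ ∷ h₃ ∷ h₄ ∷ []) = 𝟙 (α h₁ h₂ h₃ h₄ ≟ β h₁ h₂ h₃ h₄)

  zerosOver+doubleRoot : ∀ u → zerosOver u ℕ.+ q ℕ.* doubleRoot u ≡ q ℕ.* q ℕ.+ q
  zerosOver+doubleRoot (h₁ ∷ h₂ ∷ h₃ ∷ h₄ ∷ []) = ℕ.+-cancelʳ-≡ q _ _ (begin
    Z ℕ.+ q ℕ.* D ℕ.+ q         ≡⟨ solve 3 (λ z d q → z :+ q :* d :+ q := z :+ q :+ q :* d) refl Z D q ⟩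
    Z ℕ.+ q ℕ.+ q ℕ.* D         ≡⟨ cong (ℕ._+ q ℕ.* D) (#roots-pencil k r) ⟩
    q ℕ.* q ℕ.+ q ℕ.* P ℕ.+ q ℕ.* D ≡⟨ solve 3 (λ q p d → q :* q :+ q :* p :+ q :* d := q :* q :+ q :* (p :+ d)) refl q P D ⟩
    q ℕ.* q ℕ.+ q ℕ.* (P ℕ.+ D) ≡⟨ cong (λ n → q ℕ.* q ℕ.+ q ℕ.* n) P+D≡2 ⟩
    q ℕ.* q ℕ.+ q ℕ.* 2         ≡⟨ solve 1 (λ q → q :* q :+ q :* con 2 := q :* q :+ q :+ q) refl q ⟩
    q ℕ.* q ℕ.+ q ℕ.+ q         ∎)
    where
    open ≡-Reasoning
    k = κ h₁ h₂ h₃ h₄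
    r = ρ h₁ h₂ h₃ h₄
    Z = zerosOver (h₁ ∷ h₂ ∷ h₃ ∷ h₄ ∷ [])
    D = doubleRoot (h₁ ∷ h₂ ∷ h₃ ∷ h₄ ∷ [])
    P = #roots (r k)
    open +-*-Solver
    P+D≡2 : P ℕ.+ D ≡ 2
    P+D≡2 = trans (cong (ℕ._+ D) (sum-cong-≗ λ y → cong (λ c → 𝟙 (c ≟ 0#)) (ρ-at-κ h₁ h₂ h₃ h₄ y)))
                  (#roots-product (α h₁ h₂ h₃ h₄) (β h₁ h₂ h₃ h₄))

  #doubleRoot εVanishes : Vec (Fin q) 2 → ℕ
  #doubleRoot (h₁ ∷ h₂ ∷ []) = #roots (λ h₃ → h₃ * (h₃ + ε h₁ h₂))
  εVanishes       (h₁ ∷ h₂ ∷ []) = 𝟙 (ε h₁ h₂ ≟ 0#)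

  ∑-doubleRoot : ∑ⱽ 4 doubleRoot ≡ q ℕ.* ∑ⱽ 2 #doubleRoot
  ∑-doubleRoot = begin
    ∑ⱽ 4 doubleRoot                                 ≡⟨ ∑ⱽ-++ 2 2 doubleRoot ⟩
    ∑ⱽ 2 (λ v → ∑ⱽ 2 (λ w → doubleRoot (v ++ w)))   ≡⟨ ∑ⱽ-cong 2 over-h₃h₄ ⟩
    ∑ⱽ 2 (λ v → q ℕ.* #doubleRoot v)                ≡⟨ *-distribˡ-∑ⱽ 2 q #doubleRoot ⟨
    q ℕ.* ∑ⱽ 2 #doubleRoot                          ∎
    where
    open ≡-Reasoning
    discriminant : ∀ h₁ h₂ h₃ h₄ → 𝟙 (α h₁ h₂ h₃ h₄ ≟ β h₁ h₂ h₃ h₄) ≡ 𝟙 (h₃ * (h₃ + ε h₁ h₂) ≟ 0#)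
    discriminant h₁ h₂ h₃ h₄ = 𝟙-cong
      (λ α≡β → trans (sym (β-α h₁ h₂ h₃ h₄)) (G.x≈y⇒x∙y⁻¹≈ε (sym α≡β)))
      (λ Δ≡0 → sym (G.x∙y⁻¹≈ε⇒x≈y _ _ (trans (β-α h₁ h₂ h₃ h₄) Δ≡0)))
      (α h₁ h₂ h₃ h₄ ≟ β h₁ h₂ h₃ h₄) (h₃ * (h₃ + ε h₁ h₂) ≟ 0#)
    over-h₃h₄ : ∀ v → ∑ⱽ 2 (λ w → doubleRoot (v ++ w)) ≡ q ℕ.* #doubleRoot v
    over-h₃h₄ (h₁ ∷ h₂ ∷ []) = begin
      ∑[ h₃ < q ] ∑[ h₄ < q ] 𝟙 (α h₁ h₂ h₃ h₄ ≟ β h₁ h₂ h₃ h₄)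
        ≡⟨ sum-cong-≗ (λ h₃ → trans (sum-cong-≗ (discriminant h₁ h₂ h₃)) (∑-const q _)) ⟩
      ∑[ h₃ < q ] (q ℕ.* 𝟙 (h₃ * (h₃ + ε h₁ h₂) ≟ 0#))
        ≡⟨ *-distribˡ-sum q (λ h₃ → 𝟙 (h₃ * (h₃ + ε h₁ h₂) ≟ 0#)) ⟨
      q ℕ.* #doubleRoot (h₁ ∷ h₂ ∷ [])                          ∎

  #doubleRoot+εVanishes : ∀ v → #doubleRoot v ℕ.+ εVanishes v ≡ 2
  #doubleRoot+εVanishes (h₁ ∷ h₂ ∷ []) = trans
    (cong₂ ℕ._+_ (sum-cong-≗ λ h₃ → cong (λ c → 𝟙 (c * (h₃ + ε h₁ h₂) ≟ 0#)) (sym (R.+-identityʳ h₃)))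
                 (𝟙-cong sym sym (ε h₁ h₂ ≟ 0#) (0# ≟ ε h₁ h₂)))
    (#roots-product 0# (ε h₁ h₂))

  #roots-ε-at-0 : #roots (ε 0#) ≡ q
  #roots-ε-at-0 = trans (#roots-flat (- (0# + 0#)) (0# * 0# * 0#) -[0+0]≡0)
    (trans (cong (q ℕ.*_) (𝟙-yes (0# * 0# * 0# ≟ 0#) (trans (cong (_* 0#) (R.zeroˡ 0#)) (R.zeroˡ 0#))))
           (ℕ.*-identityʳ q))
    where -[0+0]≡0 = trans (cong (λ c → - c) (R.+-identityʳ 0#)) G.ε⁻¹≈ε

  ∑-εVanishes-char2 : two ≡ 0# → ∑ⱽ 2 εVanishes ≡ q
  ∑-εVanishes-char2 2≡0 = begin
    ∑ⱽ 2 εVanishes                 ≡⟨ ℕ.+-identityʳ _ ⟨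
    ∑ⱽ 2 εVanishes ℕ.+ 0           ≡⟨ ∑-except 0# (λ h₁ → #roots (ε h₁)) none-off-0 ⟩
    q ℕ.* 0 ℕ.+ #roots (ε 0#)  ≡⟨ cong₂ ℕ._+_ (ℕ.*-zeroʳ q) #roots-ε-at-0 ⟩
    q                          ∎
    where
    open ≡-Reasoning
    slope-0 : ∀ h₁ → - (h₁ + h₁) ≡ 0#
    slope-0 h₁ = trans (cong (λ c → - c) (trans (x+x≡two*x h₁) (trans (cong (_* h₁) 2≡0) (R.zeroˡ h₁)))) G.ε⁻¹≈ε
    none-off-0 : ∀ h₁ → h₁ ≢ 0# → #roots (ε h₁) ≡ 0
    none-off-0 h₁ h₁≢0 = trans (#roots-flat _ _ (slope-0 h₁))
      (trans (cong (q ℕ.*_) (𝟙-no (h₁ * h₁ * h₁ ≟ 0#) (h₁≢0 ∘ x*x*x≡0⇒x≡0 h₁))) (ℕ.*-zeroʳ q))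

  ∑-εVanishes-odd : two ≢ 0# → ∑ⱽ 2 εVanishes ℕ.+ 1 ≡ q ℕ.+ q
  ∑-εVanishes-odd 2≢0 = begin
    ∑ⱽ 2 εVanishes ℕ.+ 1           ≡⟨ ∑-except 0# (λ h₁ → #roots (ε h₁)) one-off-0 ⟩
    q ℕ.* 1 ℕ.+ #roots (ε 0#)  ≡⟨ cong₂ ℕ._+_ (ℕ.*-identityʳ q) #roots-ε-at-0 ⟩
    q ℕ.+ q                    ∎
    where
    open ≡-Reasoning
    one-off-0 : ∀ h₁ → h₁ ≢ 0# → #roots (ε h₁) ≡ 1
    one-off-0 h₁ h₁≢0 = #roots-affine _ _ λ -[h₁+h₁]≡0 →
      [ 2≢0 , h₁≢0 ]′ (x*y≡0⇒x≡0∨y≡0 two h₁ (trans (sym (x+x≡two*x h₁))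
        (trans (sym (G.⁻¹-involutive (h₁ + h₁))) (trans (cong (λ c → - c) -[h₁+h₁]≡0) G.ε⁻¹≈ε))))

  zeros-4422 : ∑ⱽ 7 (λ u → 𝟙 (s₄₄₂₂ⱽ u ≟ 0#)) ℕ.+ 2 ℕ.* q ℕ.^ 4
               ≡ q ℕ.^ 6 ℕ.+ q ℕ.^ 5 ℕ.+ q ℕ.^ 2 ℕ.* ∑ⱽ 2 εVanishes
  zeros-4422 = begin
    T ℕ.+ 2 ℕ.* q ℕ.^ 4
      ≡⟨ solve 2 (λ t q → t :+ con 2 :* q :^ 4 := t :+ q :^ 2 :* (q :^ 2 :* con 2)) refl T q ⟩
    T ℕ.+ q ℕ.^ 2 ℕ.* (q ℕ.^ 2 ℕ.* 2)
      ≡⟨ cong (λ n → T ℕ.+ q ℕ.^ 2 ℕ.* n) quadratic-in-h₃ ⟨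
    T ℕ.+ q ℕ.^ 2 ℕ.* (A ℕ.+ E)
      ≡⟨ solve 4 (λ t q a e → t :+ q :^ 2 :* (a :+ e) := t :+ q :* (q :* a) :+ q :^ 2 :* e) refl T q A E ⟩
    T ℕ.+ q ℕ.* (q ℕ.* A) ℕ.+ q ℕ.^ 2 ℕ.* E
      ≡⟨ cong (λ n → T ℕ.+ q ℕ.* n ℕ.+ q ℕ.^ 2 ℕ.* E) ∑-doubleRoot ⟨
    T ℕ.+ q ℕ.* ∑ⱽ 4 doubleRoot ℕ.+ q ℕ.^ 2 ℕ.* E
      ≡⟨ cong (ℕ._+ q ℕ.^ 2 ℕ.* E) fibres ⟩
    q ℕ.^ 4 ℕ.* (q ℕ.* q ℕ.+ q) ℕ.+ q ℕ.^ 2 ℕ.* E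
      ≡⟨ solve 2 (λ q e → q :^ 4 :* (q :* q :+ q) :+ q :^ 2 :* e := q :^ 6 :+ q :^ 5 :+ q :^ 2 :* e) refl q E ⟩
    q ℕ.^ 6 ℕ.+ q ℕ.^ 5 ℕ.+ q ℕ.^ 2 ℕ.* E ∎
    where
    open ≡-Reasoning
    open +-*-Solver
    T = ∑ⱽ 7 (λ u → 𝟙 (s₄₄₂₂ⱽ u ≟ 0#))
    A = ∑ⱽ 2 #doubleRoot
    E = ∑ⱽ 2 εVanishes
    quadratic-in-h₃ : A ℕ.+ E ≡ q ℕ.^ 2 ℕ.* 2
    quadratic-in-h₃ = trans (sym (∑ⱽ-distrib-+ 2 #doubleRoot εVanishes)) (trans (∑ⱽ-cong 2 #doubleRoot+εVanishes) (∑ⱽ-const 2 2))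
    fibres : T ℕ.+ q ℕ.* ∑ⱽ 4 doubleRoot ≡ q ℕ.^ 4 ℕ.* (q ℕ.* q ℕ.+ q)
    fibres = begin
      T ℕ.+ q ℕ.* ∑ⱽ 4 doubleRoot
        ≡⟨ cong₂ ℕ._+_ (∑ⱽ-++ 4 3 (λ u → 𝟙 (s₄₄₂₂ⱽ u ≟ 0#))) (*-distribˡ-∑ⱽ 4 q doubleRoot) ⟩
      ∑ⱽ 4 zerosOver ℕ.+ ∑ⱽ 4 (λ u → q ℕ.* doubleRoot u)
        ≡⟨ ∑ⱽ-distrib-+ 4 zerosOver (λ u → q ℕ.* doubleRoot u) ⟨
      ∑ⱽ 4 (λ u → zerosOver u ℕ.+ q ℕ.* doubleRoot u)
        ≡⟨ ∑ⱽ-cong 4 zerosOver+doubleRoot ⟩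
      ∑ⱽ 4 (λ _ → q ℕ.* q ℕ.+ q)
        ≡⟨ ∑ⱽ-const 4 _ ⟩
      q ℕ.^ 4 ℕ.* (q ℕ.* q ℕ.+ q) ∎

open FiniteFieldCounting
open Schur4422Count

open import Data.Nat.Base using (_+_; _*_; _∸_; _^_; _≤_; _%_)
open import Data.Nat.Properties using (+-cancelʳ-≡; *-identityʳ; *-suc; m+n∸m≡n; m+[n∸m]≡n; ^-distribˡ-+-*)
open +-*-Solver

module _ (p : ℕ) where

  private
    q = suc p

  q²∸q : q ^ 2 ∸ q ≡ q * p
  q²∸q = trans (cong (_∸ q) (trans (cong (q *_) (*-identityʳ q)) (*-suc q p))) (m+n∸m≡n q (q * p))

  count-even : ∀ T → T + 2 * q ^ 4 ≡ q ^ 6 + q ^ 5 + q ^ 2 * q →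
               T ≡ q * q * (q ^ 4 + (q ∸ 1) * (q ^ 2 ∸ q))
  count-even T eq = +-cancelʳ-≡ (2 * q ^ 4) _ _ (trans eq (begin
    q ^ 6 + q ^ 5 + q ^ 2 * q
      ≡⟨ solve 1 (λ p → let q = con 1 :+ p in
           q :^ 6 :+ q :^ 5 :+ q :^ 2 :* q := q :* q :* (q :^ 4 :+ p :* (q :* p)) :+ con 2 :* q :^ 4) refl p ⟩
    q * q * (q ^ 4 + p * (q * p)) + 2 * q ^ 4
      ≡⟨ cong (λ n → q * q * (q ^ 4 + p * n) + 2 * q ^ 4) q²∸q ⟨
    q * q * (q ^ 4 + (q ∸ 1) * (q ^ 2 ∸ q)) + 2 * q ^ 4 ∎))
    where open ≡-Reasoning

  count-odd : ∀ T G → T + 2 * q ^ 4 ≡ q ^ 6 + q ^ 5 + q ^ 2 * G → G + 1 ≡ q + q →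
              T ≡ q * q * (q ^ 4 + (q ∸ 1) * (q ^ 2 ∸ q + 1))
  count-odd T G eq G+1≡2q = +-cancelʳ-≡ (2 * q ^ 4 + q ^ 2) _ _ (begin
    T + (2 * q ^ 4 + q ^ 2)
      ≡⟨ solve 3 (λ t a b → t :+ (a :+ b) := t :+ a :+ b) refl T (2 * q ^ 4) (q ^ 2) ⟩
    T + 2 * q ^ 4 + q ^ 2
      ≡⟨ cong (_+ q ^ 2) eq ⟩
    q ^ 6 + q ^ 5 + q ^ 2 * G + q ^ 2
      ≡⟨ solve 2 (λ g q → q :^ 6 :+ q :^ 5 :+ q :^ 2 :* g :+ q :^ 2 := q :^ 6 :+ q :^ 5 :+ q :^ 2 :* (g :+ con 1)) refl G q ⟩
    q ^ 6 + q ^ 5 + q ^ 2 * (G + 1)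
      ≡⟨ cong (λ n → q ^ 6 + q ^ 5 + q ^ 2 * n) G+1≡2q ⟩
    q ^ 6 + q ^ 5 + q ^ 2 * (q + q)
      ≡⟨ solve 1 (λ p → let q = con 1 :+ p in
           q :^ 6 :+ q :^ 5 :+ q :^ 2 :* (q :+ q)
             := q :* q :* (q :^ 4 :+ p :* (q :* p :+ con 1)) :+ (con 2 :* q :^ 4 :+ q :^ 2)) refl p ⟩
    q * q * (q ^ 4 + p * (q * p + 1)) + (2 * q ^ 4 + q ^ 2)
      ≡⟨ cong (λ n → q * q * (q ^ 4 + p * (n + 1)) + (2 * q ^ 4 + q ^ 2)) q²∸q ⟨
    q * q * (q ^ 4 + (q ∸ 1) * (q ^ 2 ∸ q + 1)) + (2 * q ^ 4 + q ^ 2) ∎)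
    where open ≡-Reasoning

  rescale : ∀ t T W → T ≡ q * q * W → q ^ t * T * q ^ 5 ≡ W * q ^ (7 + t)
  rescale t T W refl = trans
    (solve 3 (λ w x q → x :* (q :* q :* w) :* q :^ 5 := w :* (q :^ 7 :* x)) refl W (q ^ t) q)
    (cong (W *_) (sym (^-distribˡ-+-* q 7 t)))

proposition5p6 : (q : ℕ) → IsPrimePower q → (F : FiniteField q) →
    (m : ℕ) → 7 ≤ m →
    ((q % 2 ≡ 0 →
        zeroCount F 4 lam4422 m * q ^ 5 ≡ (q ^ 4 + (q ∸ 1) * (q ^ 2 ∸ q)) * q ^ m)
     × (q % 2 ≡ 1 →
        zeroCount F 4 lam4422 m * q ^ 5 ≡ (q ^ 4 + (q ∸ 1) * (q ^ 2 ∸ q + 1)) * q ^ m))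
proposition5p6 zero    _ F _ _ with FiniteField.0F F
... | ()
proposition5p6 (suc p) _ F m 7≤m with m ∸ 7 | m+[n∸m]≡n 7≤m
... | t | refl = even , odd
  where
  q = suc p
  T : ℕ
  T = ∑ⱽ F 7 (λ u → 𝟙 (s₄₄₂₂ⱽ F u ≟ FiniteField.0F F))
  rescaled : ∀ {W} → T ≡ q * q * W → zeroCount F 4 lam4422 (7 + t) * q ^ 5 ≡ W * q ^ (7 + t)
  rescaled T≡q²W = trans (cong (_* q ^ 5) (zeroCount-4422 F t)) (rescale p t T _ T≡q²W)
  even = λ q-even → rescaled (count-even p T (trans (zeros-4422 F)
    (cong (λ G → q ^ 6 + q ^ 5 + q ^ 2 * G) (∑-εVanishes-char2 F (even⇒two≡0 F q-even)))))
  odd = λ q-odd → rescaled (count-odd p T _ (zeros-4422 F) (∑-εVanishes-odd F (odd⇒two≢0 F q-odd)))
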